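{- Let $S_0$ be a finite set of places of $\mathbb{Q}$ containing $\infty$. Let $J$ be a non-empty finite set and for $i\in J$ let $c_i,d_i\in\mathbb{Z}_{S_0}$ be coprime with $c_i\ne 0$ and $\Delta_{i,j}:=c_i\frac{d_j}{c_j}-d_i\neq0$ for $i\neq j$. Put $p_i(t)=c_it+d_i$, $p_{J'}=\prod_{i\in J'}p_i$. Let $a,b\in\mathbb{Z}_{S_0}\setminus\{0\}$, $d=ab$, $J=A\cup B$ a partition, and $\mathcal{U}:a\,p_A(t)x^2+b\,p_B(t)y^2=1\subseteq\mathbb{A}^3_{\mathbb{Z}_{S_0}}$. Let $v\notin S_0\cup S_{\mathrm{bad}}$ be a place, let $t_v\in\mathbb{Z}_v^*$ and $i\in J$ with $\mathrm{val}_v(p_i(t_v))>0$, and let $\mathcal{U}_{t_v}$ denote the fibre of $\mathcal{U}$ above $t_v$, i.e. the $\mathbb{Z}_v$-scheme $a\,p_A(t_v)x^2+b\,p_B(t_v)y^2=1$. Then $\mathcal{U}_{t_v}(\mathbb{Z}_v)\neq\emptyset$ if and only if: $a\,p_A(-d_i/c_i)$ is a square in $\mathbb{Z}_v^*$ when $i\notin A$, and $b\,p_B(-d_i/c_i)$ is a square in $\mathbb{Z}_v^*$ when $i\in A$.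
   Context: $S_{\mathrm{bad}}$ is the set of places $v\notin S_0$ such that $v\mid\Delta_{i,j}$ for some $i\neq j$, or $v\mid d$, or $v=2$, or $\mathrm{val}_v(p_J(t))>0$ for every $t\in\mathbb{Z}_v$. -}

module Defs where

open import Data.Nat as ℕ using (ℕ; zero; suc; _∸_)
open import Data.Nat.Divisibility as ℕD using ()
open import Data.Nat.Primality using (Prime)
open import Data.Integer as ℤ using (ℤ; +_)
open import Data.Integer.Divisibility as ℤD using ()
open import Data.Rational as ℚ using (ℚ; 0ℚ; 1ℚ; ↥_; ↧_; ↧ₙ_; ≢-nonZero)
open import Data.Rational.Properties as ℚP using ()
open import Data.Fin using (Fin)
open import Data.Bool using (Bool; true; false)
open import Data.List using (List)
open import Data.List.Membership.Propositional using (_∈_)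
open import Data.Product using (Σ; Σ-syntax; _×_; _,_; proj₁)
open import Data.Sum using (_⊎_)
open import Relation.Nullary using (¬_; yes; no)
open import Relation.Binary.PropositionalEquality using (_≡_; _≢_)

-- Places of ℚ.  A finite set S₀ of places containing ∞ is represented by
-- the list of its finite places (primes); ∞ is implicitly included.

IsSInt : List ℕ → ℚ → Set
IsSInt S₀ r = ∀ p → Prime p → p ℕD.∣ (↧ₙ r) → p ∈ S₀

CoprimeS : List ℕ → ℚ → ℚ → Set
CoprimeS S₀ c d = Σ[ u ∈ ℚ ] Σ[ w ∈ ℚ ]
  (IsSInt S₀ u × IsSInt S₀ w × (u ℚ.* c ℚ.+ w ℚ.* d ≡ 1ℚ))

-- Total division on ℚ (x / 0 := 0; only ever used with nonzero divisor).
divQ : ℚ → ℚ → ℚ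
divQ x y with y ℚP.≟ 0ℚ
... | yes _ = 0ℚ
... | no y≢0 = ℚ._÷_ x y {{≢-nonZero y≢0}}

Δ : ∀ {k} → (Fin k → ℚ) → (Fin k → ℚ) → Fin k → Fin k → ℚ
Δ c d i j = c i ℚ.* divQ (d j) (c j) ℚ.- d i

prodSelℚ : ∀ {k} → (Fin k → Bool) → (Fin k → ℚ) → ℚ
prodSelℚ {zero} s f = 1ℚ
prodSelℚ {suc k} s f with s Fin.zero
... | true  = f Fin.zero ℚ.* prodSelℚ (λ j → s (Fin.suc j)) (λ j → f (Fin.suc j))
... | false = prodSelℚ (λ j → s (Fin.suc j)) (λ j → f (Fin.suc j))
  where import Data.Fin as Fin

pSelℚ : ∀ {k} → (Fin k → ℚ) → (Fin k → ℚ) → (Fin k → Bool) → ℚ → ℚ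
pSelℚ c d s r = prodSelℚ s (λ j → c j ℚ.* r ℚ.+ d j)

-- v-adic valuation of a rational is positive: v divides the numerator.
DivQ : ℕ → ℚ → Set
DivQ v r = (+ v) ℤD.∣ (↥ r)

-- ℤ_p as the inverse limit lim ℤ/p^n, represented by compatible sequences
-- of integers (x_n mod p^n), with equality "x_n ≡ y_n mod p^n for all n".

Seq : Set
Seq = ℕ → ℤ

module _ (p : ℕ) where

  _≈_ : Seq → Seq → Set
  f ≈ g = ∀ n → (+ (p ℕ.^ n)) ℤD.∣ (f n ℤ.- g n)

  Compatible : Seq → Set
  Compatible f = ∀ n → (+ (p ℕ.^ n)) ℤD.∣ (f (suc n) ℤ.- f n)

  Zp : Set
  Zp = Σ Seq Compatible

  -- canonical image of a rational with v ∤ denominator in ℤ_p: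
  -- n-th component  num · den^(φ(p^(n+1)) - 1)  (Euler inverse of den)
  ι : ℚ → Seq
  ι r n = ↥ r ℤ.* ((↧ r) ℤ.^ ((p ℕ.^ n) ℕ.* (p ∸ 1) ∸ 1))

  ValPos : Seq → Set
  ValPos f = (+ p) ℤD.∣ f 1

  IsUnit : Seq → Set
  IsUnit f = Σ[ w ∈ Zp ] ((λ n → f n ℤ.* proj₁ w n) ≈ (λ _ → ℤ.1ℤ))

  SquareUnit : ℚ → Set
  SquareUnit r = (¬ (p ℕD.∣ ↧ₙ r)) ×
    (Σ[ u ∈ Zp ] (IsUnit (proj₁ u) × ((λ n → proj₁ u n ℤ.* proj₁ u n) ≈ ι r)))

  prodSelSeq : ∀ {k} → (Fin k → Bool) → (Fin k → Seq) → Seq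
  prodSelSeq {zero} s f = λ _ → ℤ.1ℤ
  prodSelSeq {suc k} s f with s Fin.zero
  ... | true  = λ n → f Fin.zero n ℤ.* prodSelSeq (λ j → s (Fin.suc j)) (λ j → f (Fin.suc j)) n
  ... | false = prodSelSeq (λ j → s (Fin.suc j)) (λ j → f (Fin.suc j))
    where import Data.Fin as Fin

  pᵢ : ∀ {k} → (Fin k → ℚ) → (Fin k → ℚ) → Fin k → Seq → Seq
  pᵢ c d i t n = ι (c i) n ℤ.* t n ℤ.+ ι (d i) n

  pSel : ∀ {k} → (Fin k → ℚ) → (Fin k → ℚ) → (Fin k → Bool) → Seq → Seq
  pSel c d s t = prodSelSeq s (λ j → pᵢ c d j t)

  -- membership in S_bad (for a place v = p not in S₀)
  Bad : ∀ {k} → (Fin k → ℚ) → (Fin k → ℚ) → ℚ → Set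
  Bad {k} c d dd =
    (Σ[ i ∈ Fin k ] Σ[ j ∈ Fin k ] (i ≢ j × DivQ p (Δ c d i j)))
    ⊎ DivQ p dd
    ⊎ p ≡ 2
    ⊎ (∀ (t : Zp) → ValPos (pSel c d (λ _ → true) (proj₁ t)))

  FibrePoint : ∀ {k} → (Fin k → ℚ) → (Fin k → ℚ) → ℚ → ℚ → (Fin k → Bool) → Seq → Set
  FibrePoint c d a b inA t = Σ[ x ∈ Zp ] Σ[ y ∈ Zp ]
    ((λ n → ι a n ℤ.* pSel c d inA t n ℤ.* (proj₁ x n ℤ.* proj₁ x n)
        ℤ.+ ι b n ℤ.* pSel c d (λ j → not (inA j)) t n ℤ.* (proj₁ y n ℤ.* proj₁ y n))
      ≈ (λ _ → ℤ.1ℤ))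
    where open import Data.Bool using (not)

-- Let v | p_i(t). Since v ∤ Δ_{j,i}, every other p_j(t) is a v-adic unit, and since c_i, d_i are
-- coprime, c_i is a unit and t ≡ -d_i/c_i (mod v). Say i ∉ A and put Q = a p_A(t), B = b p_B(t):
-- then Q is a unit and v | B. A point of Q x² + B y² = 1 gives Q x² ≡ 1, so Q ≡ (Q x)² is a square
-- mod v; conversely Hensel's lemma (v odd) lifts a square root of Q mod v to √Q ∈ ℤ_v, and
-- (x, y) = (√Q / Q, 0) is a point. Finally Q ≡ a p_A(-d_i/c_i) (mod v), and a v-adic unit is a square
-- iff its residue is, again by Hensel. The case i ∈ A is the same with the roles of a and b swapped.
-- ℤ_v is modelled by compatible sequences modulo vⁿ; a v-integral rational enters by inverting its
-- denominator with Euler's theorem, itself derived from Fermat's little theorem via the binomial theorem.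

module Submission where

open import Defs

import Algebra.Properties.CommutativeSemiring.Binomial as Binomial
import Algebra.Properties.Semiring.Exp as Exp
open import Data.Bool using (Bool; true; false; not)
open import Data.Empty using (⊥-elim)
open import Data.Fin as Fin using (Fin; toℕ; fromℕ; inject₁)
import Data.Fin.Properties as Fin
open import Data.Integer as ℤ using (ℤ; +_; _+_; _*_; _-_; -_; _^_)
import Data.Integer.Divisibility as ℤᵘ
open import Data.Integer.Divisibility.Signed
  using (_∣_; divides; ∣ᵤ⇒∣; ∣⇒∣ᵤ; ∣m∣n⇒∣m+n; ∣m⇒∣-m; ∣n⇒∣m*n; ∣m⇒∣m*n; ∣-trans; ∣-refl; *-monoʳ-∣)
open import Data.Integer.DivMod using (a≡a%ℕn+[a/ℕn]*n)
import Data.Integer.Properties as ℤ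
open import Data.Integer.Tactic.RingSolver using (solve; solve-∀)
open import Algebra.Definitions.RawMonoid ℤ.+-0-rawMonoid using (sum) renaming (_×_ to _·_)
open import Algebra.Properties.CommutativeSemigroup ℤ.*-commutativeSemigroup using (interchange)
open import Data.List using (List; []; _∷_)
open import Data.List.Membership.Propositional using (_∉_)
open import Data.List.Relation.Unary.All using (All)
open import Data.Nat as ℕ using (ℕ; zero; suc; _<_; _∸_; _!)
open import Data.Nat.Combinatorics using (_C_; nCk≡n!/k![n-k]!; k![n∸k]!∣n!; nCn≡1)
import Data.Nat.Coprimality as Coprime
import Data.Nat.Divisibility as ℕ
open import Data.Nat.DivMod using (m/n*n≡m)
open import Data.Nat.Primality using (Prime; euclidsLemma; prime⇒nonZero; prime⇒nonTrivial)
import Data.Nat.Properties as ℕ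
open import Data.Nat.Properties using (_!*_!≢0)
open import Data.Product using (Σ-syntax; _×_; _,_; proj₁; proj₂)
open import Data.Rational as ℚ using (ℚ; 0ℚ; ↥_; ↧_; ↧ₙ_; mkℚ)
import Data.Rational.Properties as ℚ
import Data.Rational.Unnormalised as ℚᵘ
open import Data.Sum using (inj₁; inj₂; [_,_]′)
open import Function using (id; flip; _∘_)
open import Function.Bundles using (_⇔_; mk⇔; Equivalence)
open import Function.Construct.Composition using (_⇔-∘_)
open import Function.Construct.Symmetry using (⇔-sym)
open import Level using (0ℓ)
open import Relation.Binary.Bundles using (Setoid)
open import Relation.Binary.PropositionalEquality
  using (_≡_; _≢_; refl; sym; trans; cong; cong₂; subst; subst₂; module ≡-Reasoning)
import Relation.Binary.Reasoning.Setoid as SetoidReasoning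
open import Relation.Nullary using (¬_; contradiction; yes; no)

-- Congruences modulo an integer

-- A record rather than a synonym for m ∣ x - y, so that x, y and m are inferable from a proof.
infix 4 _≡_[mod_]
record _≡_[mod_] (x y m : ℤ) : Set where
  constructor ∣⇒≡mod
  field ≡mod⇒∣ : m ∣ x - y
open _≡_[mod_] public

module _ {m : ℤ} where

  private
    ∣-resp : ∀ {x y} → x ≡ y → m ∣ x → m ∣ y
    ∣-resp = subst (m ∣_)

  ≡mod-reflexive : ∀ {x y} → x ≡ y → x ≡ y [mod m ]
  ≡mod-reflexive {x} refl = ∣⇒≡mod (divides (+ 0) (solve (x ∷ m ∷ [])))

  ≡mod-refl : ∀ {x} → x ≡ x [mod m ]
  ≡mod-refl = ≡mod-reflexive refl

  ≡mod-sym : ∀ {x y} → x ≡ y [mod m ] → y ≡ x [mod m ]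
  ≡mod-sym {x} {y} (∣⇒≡mod d) = ∣⇒≡mod (∣-resp { - (x - y)} (solve (x ∷ y ∷ [])) (∣m⇒∣-m d))

  ≡mod-trans : ∀ {x y z} → x ≡ y [mod m ] → y ≡ z [mod m ] → x ≡ z [mod m ]
  ≡mod-trans {x} {y} {z} (∣⇒≡mod d) (∣⇒≡mod e) =
    ∣⇒≡mod (∣-resp {(x - y) + (y - z)} (solve (x ∷ y ∷ z ∷ [])) (∣m∣n⇒∣m+n d e))

  +-cong-mod : ∀ {x x′ y y′} → x ≡ x′ [mod m ] → y ≡ y′ [mod m ] → x + y ≡ x′ + y′ [mod m ]
  +-cong-mod {x} {x′} {y} {y′} (∣⇒≡mod d) (∣⇒≡mod e) =
    ∣⇒≡mod (∣-resp {(x - x′) + (y - y′)} (solve (x ∷ x′ ∷ y ∷ y′ ∷ [])) (∣m∣n⇒∣m+n d e))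

  neg-cong-mod : ∀ {x x′} → x ≡ x′ [mod m ] → - x ≡ - x′ [mod m ]
  neg-cong-mod {x} {x′} (∣⇒≡mod d) =
    ∣⇒≡mod (∣-resp { - (x - x′)} (solve (x ∷ x′ ∷ [])) (∣m⇒∣-m d))

  *-cong-mod : ∀ {x x′ y y′} → x ≡ x′ [mod m ] → y ≡ y′ [mod m ] → x * y ≡ x′ * y′ [mod m ]
  *-cong-mod {x} {x′} {y} {y′} (∣⇒≡mod d) (∣⇒≡mod e) =
    ∣⇒≡mod (∣-resp {(x - x′) * y + x′ * (y - y′)} (solve (x ∷ x′ ∷ y ∷ y′ ∷ []))
                   (∣m∣n⇒∣m+n (∣m⇒∣m*n y d) (∣n⇒∣m*n x′ e)))

  ^-cong-mod : ∀ {x y} n → x ≡ y [mod m ] → x ^ n ≡ y ^ n [mod m ]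
  ^-cong-mod zero    _  = ≡mod-refl
  ^-cong-mod (suc n) eq = *-cong-mod eq (^-cong-mod n eq)

  ∣⇒≡0-mod : ∀ {x} → m ∣ x → x ≡ + 0 [mod m ]
  ∣⇒≡0-mod {x} d = ∣⇒≡mod (∣-resp {x} (solve (x ∷ [])) d)

  ≡0-mod⇒∣ : ∀ {x} → x ≡ + 0 [mod m ] → m ∣ x
  ≡0-mod⇒∣ {x} (∣⇒≡mod d) = ∣-resp {x - + 0} (solve (x ∷ [])) d

≡mod-setoid : ℤ → Setoid 0ℓ 0ℓ
≡mod-setoid m = record
  { Carrier       = ℤ
  ; _≈_           = λ x y → x ≡ y [mod m ]
  ; isEquivalence = record { refl = ≡mod-refl ; sym = ≡mod-sym ; trans = ≡mod-trans }
  }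

module ≡mod-Reasoning (m : ℤ) = SetoidReasoning (≡mod-setoid m)

≡mod-weaken : ∀ {m n x y} → n ∣ m → x ≡ y [mod m ] → x ≡ y [mod n ]
≡mod-weaken n∣m (∣⇒≡mod d) = ∣⇒≡mod (∣-trans n∣m d)

*-≡0-mod : ∀ {m n x y} → x ≡ + 0 [mod m ] → y ≡ + 0 [mod n ] → x * y ≡ + 0 [mod m * n ]
*-≡0-mod {m} {n} {x} {y} x≡0 y≡0 with ≡0-mod⇒∣ x≡0 | ≡0-mod⇒∣ y≡0
... | divides q refl | divides r refl = ∣⇒≡0-mod (divides (q * r) (interchange q m r n))

+-multiple-≡mod : ∀ {m} x q → x + q * m ≡ x [mod m ]
+-multiple-≡mod {m} x q = ∣⇒≡mod (divides q (x+qm-x≡qm x q m))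
  where x+qm-x≡qm : ∀ x q m → x + q * m - x ≡ q * m
        x+qm-x≡qm = solve-∀

≡mod-1 : ∀ {x y} → x ≡ y [mod + 1 ]
≡mod-1 {x} {y} = ∣⇒≡mod (divides (x - y) (sym (ℤ.*-identityʳ (x - y))))

inverse-unique-mod : ∀ {m a u v} → a * u ≡ + 1 [mod m ] → a * v ≡ + 1 [mod m ] → u ≡ v [mod m ]
inverse-unique-mod {m} {a} {u} {v} au≡1 av≡1 = begin
  u               ≡⟨ ℤ.*-identityʳ u ⟨
  u * + 1         ≈⟨ *-cong-mod (≡mod-refl {x = u}) (≡mod-sym av≡1) ⟩
  u * (a * v)     ≡⟨ u[av]≡[au]v u a v ⟩
  a * u * v       ≈⟨ *-cong-mod au≡1 (≡mod-refl {x = v}) ⟩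
  + 1 * v         ≡⟨ ℤ.*-identityˡ v ⟩
  v               ∎
  where
  open ≡mod-Reasoning m
  u[av]≡[au]v : ∀ u a v → u * (a * v) ≡ a * u * v
  u[av]≡[au]v = solve-∀

SquareMod : ℤ → ℤ → Set
SquareMod m z = Σ[ w ∈ ℤ ] w * w ≡ z [mod m ]

newton-sqrt-step : ∀ {M N a e h} → N ∣ M → e ≡ + 0 [mod M ] → + 2 * a * h ≡ + 1 [mod N ] →
                   (a + e * h) * (a + e * h) ≡ a * a + e [mod M * N ]
newton-sqrt-step {M} {N} {a} {e} {h} N∣M e≡0 2ah≡1 =
  ∣⇒≡mod (subst (M * N ∣_) (sym (expand a e h)) (≡0-mod⇒∣ (+-cong-mod linear quadratic)))
  where
  expand : ∀ a e h → (a + e * h) * (a + e * h) - (a * a + e) ≡ e * (+ 2 * a * h - + 1) + e * e * (h * h)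
  expand = solve-∀
  linear : e * (+ 2 * a * h - + 1) ≡ + 0 [mod M * N ]
  linear = *-≡0-mod e≡0 (∣⇒≡0-mod (≡mod⇒∣ 2ah≡1))
  quadratic : e * e * (h * h) ≡ + 0 [mod M * N ]
  quadratic =
    ∣⇒≡0-mod (∣m⇒∣m*n (h * h) (∣-trans (*-monoʳ-∣ M N∣M) (≡0-mod⇒∣ (*-≡0-mod e≡0 e≡0))))

geometricSum : ℤ → ℕ → ℤ
geometricSum y zero    = + 0
geometricSum y (suc k) = + 1 + y * geometricSum y k

geometricSum-telescope : ∀ y k → (y - + 1) * geometricSum y k ≡ y ^ k - + 1
geometricSum-telescope y zero    = ℤ.*-zeroʳ (y - + 1)
geometricSum-telescope y (suc k) = begin
  (y - + 1) * (+ 1 + y * G)         ≡⟨ expand y G ⟩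
  (y - + 1) + y * ((y - + 1) * G)   ≡⟨ cong (λ z → (y - + 1) + y * z) (geometricSum-telescope y k) ⟩
  (y - + 1) + y * (y ^ k - + 1)     ≡⟨ collapse y (y ^ k) ⟩
  y * y ^ k - + 1                   ∎
  where
  open ≡-Reasoning
  G = geometricSum y k
  expand : ∀ y g → (y - + 1) * (+ 1 + y * g) ≡ (y - + 1) + y * ((y - + 1) * g)
  expand = solve-∀
  collapse : ∀ y z → (y - + 1) + y * (z - + 1) ≡ y * z - + 1
  collapse = solve-∀

geometricSum-≡mod : ∀ {m y} k → y ≡ + 1 [mod m ] → geometricSum y k ≡ + k [mod m ]
geometricSum-≡mod zero    _   = ≡mod-refl
geometricSum-≡mod {m} {y} (suc k) y≡1 = begin
  + 1 + y * geometricSum y k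
    ≈⟨ +-cong-mod (≡mod-refl {x = + 1}) (*-cong-mod y≡1 (geometricSum-≡mod k y≡1)) ⟩
  + 1 + + 1 * + k              ≡⟨ cong (λ z → + 1 + z) (ℤ.*-identityˡ (+ k)) ⟩
  + suc k                      ∎
  where open ≡mod-Reasoning m

·≡* : ∀ n x → n · x ≡ + n * x
·≡* zero    x = sym (ℤ.*-zeroˡ x)
·≡* (suc n) x = begin
  x + n · x         ≡⟨ cong (λ y → x + y) (·≡* n x) ⟩
  x + + n * x       ≡⟨ cong (_+ + n * x) (ℤ.*-identityˡ x) ⟨
  + 1 * x + + n * x ≡⟨ ℤ.*-distribʳ-+ x (+ 1) (+ n) ⟨
  (+ 1 + + n) * x   ∎
  where open ≡-Reasoning

sum-≡mod-last : ∀ {m} n (t : Fin (suc n) → ℤ) → (∀ j → t (inject₁ j) ≡ + 0 [mod m ]) →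
                sum t ≡ t (fromℕ n) [mod m ]
sum-≡mod-last zero    t _   = ≡mod-reflexive (ℤ.+-identityʳ (t Fin.zero))
sum-≡mod-last (suc n) t t≡0 = ≡mod-trans
  (+-cong-mod (t≡0 Fin.zero) (sum-≡mod-last n (λ j → t (Fin.suc j)) (λ j → t≡0 (Fin.suc j))))
  (≡mod-reflexive (ℤ.+-identityˡ _))

private
  module B = Binomial ℤ.+-*-commutativeSemiring
  module E = Exp ℤ.+-*-semiring

^ᴱ≡^ : ∀ z n → z E.^ n ≡ z ^ n
^ᴱ≡^ z zero    = refl
^ᴱ≡^ z (suc n) = cong (z *_) (^ᴱ≡^ z n)

module _ (x y : ℤ) where

  binomialTerm-first : ∀ n → B.binomialTerm x y n Fin.zero ≡ y ^ n
  binomialTerm-first n = begin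
    (1 · (+ 1 * y E.^ n))  ≡⟨ ℤ.+-identityʳ _ ⟩
    + 1 * y E.^ n          ≡⟨ ℤ.*-identityˡ _ ⟩
    y E.^ n                ≡⟨ ^ᴱ≡^ y n ⟩
    y ^ n                  ∎
    where open ≡-Reasoning

  binomialTerm-last : ∀ n → B.binomialTerm x y n (fromℕ n) ≡ x ^ n
  binomialTerm-last n rewrite Fin.toℕ-fromℕ n = begin
    (n C n) · (x E.^ n * y E.^ (n ∸ n))
      ≡⟨ cong₂ (λ k l → k · (x E.^ n * y E.^ l)) (nCn≡1 n) (ℕ.n∸n≡0 n) ⟩
    1 · (x E.^ n * + 1)                  ≡⟨ ℤ.+-identityʳ _ ⟩
    x E.^ n * + 1                        ≡⟨ ℤ.*-identityʳ _ ⟩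
    x E.^ n                              ≡⟨ ^ᴱ≡^ x n ⟩
    x ^ n                                ∎
    where open ≡-Reasoning

  ^-+-≡mod : ∀ {m} n → (∀ {k} → 0 < k → k < suc n → m ∣ + (suc n C k)) →
             (x + y) ^ suc n ≡ x ^ suc n + y ^ suc n [mod m ]
  ^-+-≡mod {m} n m∣C = begin
    (x + y) ^ suc n                              ≡⟨ ^ᴱ≡^ (x + y) (suc n) ⟨
    (x + y) E.^ suc n                            ≡⟨ B.theorem (suc n) x y ⟩
    t Fin.zero + sum (λ j → t (Fin.suc j))
      ≈⟨ +-cong-mod (≡mod-refl {x = t Fin.zero}) (sum-≡mod-last n (λ j → t (Fin.suc j)) interior) ⟩
    t Fin.zero + t (fromℕ (suc n))
      ≡⟨ cong₂ _+_ (binomialTerm-first (suc n)) (binomialTerm-last (suc n)) ⟩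
    y ^ suc n + x ^ suc n                        ≡⟨ ℤ.+-comm (y ^ suc n) (x ^ suc n) ⟩
    x ^ suc n + y ^ suc n                        ∎
    where
    open ≡mod-Reasoning m
    t = B.binomialTerm x y (suc n)
    interior : ∀ j → t (Fin.suc (inject₁ j)) ≡ + 0 [mod m ]
    interior j = ∣⇒≡0-mod (subst (m ∣_) (sym (·≡* (suc n C toℕ k) b))
      (∣m⇒∣m*n b (m∣C (ℕ.s≤s ℕ.z≤n) (ℕ.s≤s (Fin.inject₁ℕ< j)))))
      where k = Fin.suc (inject₁ j)
            b = B.binomial x y (suc n) k

nCk*k![n∸k]!≡n! : ∀ {n k} → k ℕ.≤ n → (n C k) ℕ.* (k ! ℕ.* (n ∸ k) !) ≡ n !
nCk*k![n∸k]!≡n! {n} {k} k≤n = trans (cong (ℕ._* (k ! ℕ.* (n ∸ k) !)) (nCk≡n!/k![n-k]! k≤n))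
  (m/n*n≡m {{k ℕ.!* (n ∸ k) !≢0}} (k![n∸k]!∣n! k≤n))

-- Stated through ∣ x ∣ so that it agrees definitionally with the conditions in IsSInt, DivQ and SquareUnit.
infix 4 _∤ᶻ_
_∤ᶻ_ : ℕ → ℤ → Set
p ∤ᶻ x = ¬ (p ℕ.∣ ℤ.∣ x ∣)

∤ᶻ-*ˡ : ∀ {p x y} → p ∤ᶻ x * y → p ∤ᶻ x
∤ᶻ-*ˡ {p} {x} {y} p∤xy p∣x =
  p∤xy (subst (p ℕ.∣_) (sym (ℤ.abs-* x y)) (ℕ.∣m⇒∣m*n ℤ.∣ y ∣ p∣x))

∤ᶻ-neg : ∀ {p x} → p ∤ᶻ - x → p ∤ᶻ x
∤ᶻ-neg {p} {x} p∤-x p∣x = p∤-x (subst (p ℕ.∣_) (sym (ℤ.∣-i∣≡∣i∣ x)) p∣x)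

module Compatibility (p : ℕ) where

  p∣p^[1+n] : ∀ n → + p ∣ + (p ℕ.^ suc n)
  p∣p^[1+n] n = ∣ᵤ⇒∣ (ℕ.m∣m*n (p ℕ.^ n))

  p^n∣p^[1+n] : ∀ n → + (p ℕ.^ n) ∣ + (p ℕ.^ suc n)
  p^n∣p^[1+n] n = ∣ᵤ⇒∣ (ℕ.n∣m*n p)

  p^[1+n]*p≡p^[2+n] : ∀ n → + (p ℕ.^ suc n) * + p ≡ + (p ℕ.^ suc (suc n))
  p^[1+n]*p≡p^[2+n] n = trans (sym (ℤ.pos-* (p ℕ.^ suc n) p)) (cong +_ (ℕ.*-comm (p ℕ.^ suc n) p))

  ≡mod-p^1⇒≡mod-p : ∀ {x y} → x ≡ y [mod + (p ℕ.^ 1) ] → x ≡ y [mod + p ]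
  ≡mod-p^1⇒≡mod-p {x} {y} = subst (λ m → x ≡ y [mod m ]) (cong +_ (ℕ.*-identityʳ p))

  ≡mod-p⇒≡mod-p^1 : ∀ {x y} → x ≡ y [mod + p ] → x ≡ y [mod + (p ℕ.^ 1) ]
  ≡mod-p⇒≡mod-p^1 {x} {y} = subst (λ m → x ≡ y [mod m ]) (cong +_ (sym (ℕ.*-identityʳ p)))

  compatible⇒≡mod : ∀ f → Compatible p f → ∀ n → f (suc n) ≡ f n [mod + (p ℕ.^ n) ]
  compatible⇒≡mod f f-comp n = ∣⇒≡mod (∣ᵤ⇒∣ (f-comp n))

  ≡mod⇒compatible : ∀ {f} → (∀ n → f (suc n) ≡ f n [mod + (p ℕ.^ n) ]) → Compatible p f
  ≡mod⇒compatible f≡ n = ∣⇒∣ᵤ (≡mod⇒∣ (f≡ n))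

  ≈⇒≡mod : ∀ {f g} → _≈_ p f g → ∀ n → f n ≡ g n [mod + (p ℕ.^ n) ]
  ≈⇒≡mod f≈g n = ∣⇒≡mod (∣ᵤ⇒∣ (f≈g n))

  ≡mod⇒≈ : ∀ {f g} → (∀ n → f n ≡ g n [mod + (p ℕ.^ n) ]) → _≈_ p f g
  ≡mod⇒≈ f≡g n = ∣⇒∣ᵤ (≡mod⇒∣ (f≡g n))

  compatible-const : ∀ k → Compatible p (λ _ → k)
  compatible-const k = ≡mod⇒compatible {λ _ → k} (λ _ → ≡mod-refl)

  compatible-+ : ∀ {f g} → Compatible p f → Compatible p g → Compatible p (λ n → f n + g n)
  compatible-+ {f} {g} f-comp g-comp = ≡mod⇒compatible {λ n → f n + g n} λ n →
    +-cong-mod (compatible⇒≡mod f f-comp n) (compatible⇒≡mod g g-comp n)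

  compatible-* : ∀ {f g} → Compatible p f → Compatible p g → Compatible p (λ n → f n * g n)
  compatible-* {f} {g} f-comp g-comp = ≡mod⇒compatible {λ n → f n * g n} λ n →
    *-cong-mod (compatible⇒≡mod f f-comp n) (compatible⇒≡mod g g-comp n)

  compatible⇒≡mod-p : ∀ f → Compatible p f → ∀ n → f (suc n) ≡ f 1 [mod + p ]
  compatible⇒≡mod-p f f-comp zero    = ≡mod-refl
  compatible⇒≡mod-p f f-comp (suc n) =
    ≡mod-trans (≡mod-weaken (p∣p^[1+n] n) (compatible⇒≡mod f f-comp (suc n)))
               (compatible⇒≡mod-p f f-comp n)

-- FibrePoint v c d a b inA t is ConicPoint v (a p_A(t)) (b p_B(t)), definitionally.
ConicPoint : ℕ → Seq → Seq → Set
ConicPoint p Q B = Σ[ x ∈ Zp p ] Σ[ y ∈ Zp p ]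
  _≈_ p (λ n → Q n * (proj₁ x n * proj₁ x n) + B n * (proj₁ y n * proj₁ y n)) (λ _ → + 1)

conic-point-swap : ∀ {p} Q B → ConicPoint p Q B → ConicPoint p B Q
conic-point-swap {p} Q B (x , y , conic) = y , x , λ n →
  subst (λ z → + (p ℕ.^ n) ℤᵘ.∣ z - + 1)
        (ℤ.+-comm (Q n * (proj₁ x n * proj₁ x n)) (B n * (proj₁ y n * proj₁ y n))) (conic n)

-- Arithmetic modulo a prime: Fermat, Euler, Hensel

module _ {p : ℕ} (p-prime : Prime p) where

  open Compatibility p public

  private instance
    p≢0 : ℕ.NonZero p
    p≢0 = prime⇒nonZero p-prime

  1<p : 1 < p
  1<p = ℕ.nonTrivial⇒n>1 p {{prime⇒nonTrivial p-prime}}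

  suc[p∸1]≡p : suc (p ∸ 1) ≡ p
  suc[p∸1]≡p = ℕ.m+[n∸m]≡n (ℕ.<⇒≤ 1<p)

  ∤ᶻ-1 : p ∤ᶻ + 1
  ∤ᶻ-1 = ℕ.>⇒∤ 1<p

  ∤ᶻ-* : ∀ {x y} → p ∤ᶻ x → p ∤ᶻ y → p ∤ᶻ x * y
  ∤ᶻ-* {x} {y} p∤x p∤y p∣xy
    with euclidsLemma ℤ.∣ x ∣ ℤ.∣ y ∣ p-prime (subst (p ℕ.∣_) (ℤ.abs-* x y) p∣xy)
  ... | inj₁ p∣x = p∤x p∣x
  ... | inj₂ p∣y = p∤y p∣y

  ∤ᶻ-resp-≡mod : ∀ {x y} → x ≡ y [mod + p ] → p ∤ᶻ x → p ∤ᶻ y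
  ∤ᶻ-resp-≡mod {x} {y} x≡y p∤x p∣y =
    p∤x (∣⇒∣ᵤ (≡0-mod⇒∣ (≡mod-trans x≡y (∣⇒≡0-mod (∣ᵤ⇒∣ p∣y)))))

  ≡mod-cancelˡ : ∀ {x a b} → p ∤ᶻ x → x * a ≡ x * b [mod + p ] → a ≡ b [mod + p ]
  ≡mod-cancelˡ {x} {a} {b} p∤x (∣⇒≡mod p∣xa-xb) =
    ∣⇒≡mod (∣ᵤ⇒∣ ([ flip contradiction p∤x , id ]′
                    (euclidsLemma ℤ.∣ x ∣ ℤ.∣ a - b ∣ p-prime p∣x[a-b])))
    where
    factor : ∀ x a b → x * a - x * b ≡ x * (a - b)
    factor = solve-∀
    p∣x[a-b] : p ℕ.∣ ℤ.∣ x ∣ ℕ.* ℤ.∣ a - b ∣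
    p∣x[a-b] =
      subst (p ℕ.∣_) (trans (cong ℤ.∣_∣ (factor x a b)) (ℤ.abs-* x (a - b))) (∣⇒∣ᵤ p∣xa-xb)

  p∤k! : ∀ {k} → k < p → ¬ (p ℕ.∣ k !)
  p∤k! {zero}  _   = ℕ.>⇒∤ 1<p
  p∤k! {suc k} k<p p∣k! with euclidsLemma (suc k) (k !) p-prime p∣k!
  ... | inj₁ p∣1+k = ℕ.>⇒∤ k<p p∣1+k
  ... | inj₂ p∣k!′ = p∤k! (ℕ.<-trans (ℕ.n<1+n k) k<p) p∣k!′

  p∣pCk : ∀ {k} → 0 < k → k < p → p ℕ.∣ p C k
  p∣pCk {k} 0<k k<p =
    [ id , ⊥-elim ∘ p∤k![p∸k]! ]′ (euclidsLemma (p C k) (k ! ℕ.* (p ∸ k) !) p-prime p∣pCk*k![p∸k]!)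
    where
    p∣pCk*k![p∸k]! : p ℕ.∣ (p C k) ℕ.* (k ! ℕ.* (p ∸ k) !)
    p∣pCk*k![p∸k]! = subst (p ℕ.∣_) (sym (nCk*k![n∸k]!≡n! (ℕ.<⇒≤ k<p)))
      (subst (λ n → n ℕ.∣ n !) suc[p∸1]≡p (ℕ.m∣m*n ((p ∸ 1) !)))
    p∤k![p∸k]! : ¬ (p ℕ.∣ k ! ℕ.* (p ∸ k) !)
    p∤k![p∸k]! p∣ = [ p∤k! k<p , p∤k! (ℕ.∸-monoʳ-< 0<k (ℕ.<⇒≤ k<p)) ]′
                      (euclidsLemma (k !) ((p ∸ k) !) p-prime p∣)

  freshman's-dream : ∀ x y → (x + y) ^ p ≡ x ^ p + y ^ p [mod + p ]
  freshman's-dream x y = subst (λ n → (x + y) ^ n ≡ x ^ n + y ^ n [mod + p ]) suc[p∸1]≡p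
    (^-+-≡mod x y (p ∸ 1) λ {k} 0<k k<p → ∣ᵤ⇒∣ (subst (λ n → p ℕ.∣ n C k) (sym suc[p∸1]≡p)
      (p∣pCk 0<k (subst (k <_) suc[p∸1]≡p k<p))))

  fermat : ∀ x → x ^ p ≡ x [mod + p ]
  fermat x = begin
    x ^ p                 ≈⟨ ^-cong-mod p x≡r ⟩
    (+ r) ^ p             ≈⟨ fermatℕ r ⟩
    + r                   ≈⟨ x≡r ⟨
    x                     ∎
    where
    open ≡mod-Reasoning (+ p)
    fermatℕ : ∀ n → (+ n) ^ p ≡ + n [mod + p ]
    fermatℕ zero    =
      ≡mod-reflexive (subst (λ k → (+ 0) ^ k ≡ + 0) suc[p∸1]≡p (ℤ.*-zeroˡ ((+ 0) ^ (p ∸ 1))))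
    fermatℕ (suc n) = begin
      (+ 1 + + n) ^ p     ≈⟨ freshman's-dream (+ 1) (+ n) ⟩
      (+ 1) ^ p + (+ n) ^ p ≈⟨ +-cong-mod (≡mod-reflexive (ℤ.^-zeroˡ p)) (fermatℕ n) ⟩
      + 1 + + n           ∎
    r = x ℤ.%ℕ p
    x≡r : x ≡ + r [mod + p ]
    x≡r = ≡mod-trans (≡mod-reflexive (a≡a%ℕn+[a/ℕn]*n x p)) (+-multiple-≡mod (+ r) (x ℤ./ℕ p))

  fermat-unit : ∀ {x} → p ∤ᶻ x → x ^ (p ∸ 1) ≡ + 1 [mod + p ]
  fermat-unit {x} p∤x = ≡mod-cancelˡ {x = x} p∤x (begin
    x * x ^ (p ∸ 1)    ≡⟨ cong (x ^_) suc[p∸1]≡p ⟩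
    x ^ p              ≈⟨ fermat x ⟩
    x                  ≡⟨ ℤ.*-identityʳ x ⟨
    x * + 1            ∎)
    where open ≡mod-Reasoning (+ p)

  ^p-≡1-lift : ∀ n {y} → y ≡ + 1 [mod + (p ℕ.^ suc n) ] →
               y ^ p ≡ + 1 [mod + (p ℕ.^ suc (suc n)) ]
  ^p-≡1-lift n {y} y≡1 = ∣⇒≡mod (subst₂ _∣_ (sym (ℤ.pos-* p (p ℕ.^ suc n)))
    (trans (ℤ.*-comm G (y - + 1)) (geometricSum-telescope y p)) (≡0-mod⇒∣ (*-≡0-mod G≡0 y-1≡0)))
    where
    G = geometricSum y p
    G≡0 : G ≡ + 0 [mod + p ]
    G≡0 = ≡mod-trans (geometricSum-≡mod p (≡mod-weaken (p∣p^[1+n] n) y≡1)) (∣⇒≡0-mod ∣-refl)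
    y-1≡0 : y - + 1 ≡ + 0 [mod + (p ℕ.^ suc n) ]
    y-1≡0 = ∣⇒≡0-mod (≡mod⇒∣ y≡1)

  euler : ∀ n {x} → p ∤ᶻ x → x ^ (p ℕ.^ n ℕ.* (p ∸ 1)) ≡ + 1 [mod + (p ℕ.^ suc n) ]
  euler zero {x} p∤x = subst₂ (λ k m → x ^ k ≡ + 1 [mod m ])
    (sym (ℕ.*-identityˡ (p ∸ 1))) (cong +_ (sym (ℕ.*-identityʳ p))) (fermat-unit p∤x)
  euler (suc n) {x} p∤x = begin
    x ^ (p ℕ.* p ℕ.^ n ℕ.* (p ∸ 1))     ≡⟨ cong (x ^_) (trans (ℕ.*-assoc p _ _) (ℕ.*-comm p _)) ⟩
    x ^ (p ℕ.^ n ℕ.* (p ∸ 1) ℕ.* p)     ≡⟨ ℤ.^-*-assoc x (p ℕ.^ n ℕ.* (p ∸ 1)) p ⟨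
    (x ^ (p ℕ.^ n ℕ.* (p ∸ 1))) ^ p     ≈⟨ ^p-≡1-lift n (euler n p∤x) ⟩
    + 1                                 ∎
    where open ≡mod-Reasoning (+ (p ℕ.^ suc (suc n)))

  euler-inverse : ∀ n {x} → p ∤ᶻ x →
                  x * x ^ (p ℕ.^ n ℕ.* (p ∸ 1) ∸ 1) ≡ + 1 [mod + (p ℕ.^ suc n) ]
  euler-inverse n {x} p∤x =
    ≡mod-trans (≡mod-reflexive (cong (x ^_) (ℕ.m+[n∸m]≡n 1≤e))) (euler n p∤x)
    where 1≤e = ℕ.*-mono-≤ (ℕ.m^n>0 p n) (ℕ.∸-monoˡ-≤ 1 1<p)

  mod-p-inverse : ∀ x → p ∤ᶻ x → Σ[ y ∈ ℤ ] x * y ≡ + 1 [mod + p ]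
  mod-p-inverse x p∤x = x ^ (p ℕ.^ 0 ℕ.* (p ∸ 1) ∸ 1) , ≡mod-p^1⇒≡mod-p (euler-inverse 0 {x} p∤x)

  -- Euler's theorem inverts s (suc n) modulo p^(n+1); the shift is needed because s 0 is only
  -- determined modulo p⁰ and may be divisible by p.
  inverseSeq : Seq → Seq
  inverseSeq s n = s (suc n) ^ (p ℕ.^ n ℕ.* (p ∸ 1) ∸ 1)

  module _ (s : Seq) (s-comp : Compatible p s) (p∤s₁ : p ∤ᶻ s 1) where

    private
      s[1+n]*inverseSeq≡1 : ∀ n → s (suc n) * inverseSeq s n ≡ + 1 [mod + (p ℕ.^ suc n) ]
      s[1+n]*inverseSeq≡1 n =
        euler-inverse n {s (suc n)} (∤ᶻ-resp-≡mod (≡mod-sym (compatible⇒≡mod-p s s-comp n)) p∤s₁)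

    inverseSeq-inverse : ∀ n → s n * inverseSeq s n ≡ + 1 [mod + (p ℕ.^ n) ]
    inverseSeq-inverse n = ≡mod-trans (*-cong-mod (≡mod-sym (compatible⇒≡mod s s-comp n)) ≡mod-refl)
      (≡mod-weaken (p^n∣p^[1+n] n) (s[1+n]*inverseSeq≡1 n))

    inverseSeq-compatible : Compatible p (inverseSeq s)
    inverseSeq-compatible = ≡mod⇒compatible {f = inverseSeq s} λ n →
      ≡mod-weaken (p^n∣p^[1+n] n) (inverse-unique-mod {a = s (suc n)}
        (≡mod-trans (*-cong-mod (≡mod-sym (compatible⇒≡mod s s-comp (suc n))) ≡mod-refl)
                    (≡mod-weaken (p^n∣p^[1+n] (suc n)) (s[1+n]*inverseSeq≡1 (suc n))))
        (s[1+n]*inverseSeq≡1 n))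

    compatible-unit : IsUnit p s
    compatible-unit = (inverseSeq s , inverseSeq-compatible) , ≡mod⇒≈ {g = λ _ → + 1} inverseSeq-inverse

  p∤ᶻ2 : p ≢ 2 → p ∤ᶻ + 2
  p∤ᶻ2 p≢2 p∣2 = p≢2 (ℕ.≤-antisym (ℕ.∣⇒≤ p∣2) 1<p)

  -- Newton's iteration for X² = s, with the derivative 2X frozen at 2 w₀.
  module Hensel (p≢2 : p ≢ 2) (s : Seq) (s-comp : Compatible p s) (p∤s₁ : p ∤ᶻ s 1)
                (w₀ : ℤ) (w₀²≡s₁ : w₀ * w₀ ≡ s 1 [mod + p ]) where

    private
      p∤w₀ : p ∤ᶻ w₀
      p∤w₀ = ∤ᶻ-*ˡ {x = w₀} {y = w₀} (∤ᶻ-resp-≡mod (≡mod-sym w₀²≡s₁) p∤s₁)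

      p∤2w₀ : p ∤ᶻ + 2 * w₀
      p∤2w₀ = ∤ᶻ-* {+ 2} {w₀} (p∤ᶻ2 p≢2) p∤w₀

      h : ℤ
      h = proj₁ (mod-p-inverse (+ 2 * w₀) p∤2w₀)

      2w₀h≡1 : + 2 * w₀ * h ≡ + 1 [mod + p ]
      2w₀h≡1 = proj₂ (mod-p-inverse (+ 2 * w₀) p∤2w₀)

      approx : ℕ → ℤ
      approx zero    = w₀
      approx (suc n) = approx n + (s (suc (suc n)) - approx n * approx n) * h

      approx-square : ∀ n → approx n * approx n ≡ s (suc n) [mod + (p ℕ.^ suc n) ]
      approx≡w₀ : ∀ n → approx n ≡ w₀ [mod + p ]

      error≡0 : ∀ n → s (suc (suc n)) - approx n * approx n ≡ + 0 [mod + (p ℕ.^ suc n) ]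
      error≡0 n = ∣⇒≡0-mod (≡mod⇒∣
        (≡mod-trans (compatible⇒≡mod s s-comp (suc n)) (≡mod-sym (approx-square n))))

      approx-compatible : ∀ n → approx (suc n) ≡ approx n [mod + (p ℕ.^ suc n) ]
      approx-compatible n = ≡mod-trans
        (+-cong-mod (≡mod-refl {x = approx n}) (*-cong-mod (error≡0 n) (≡mod-refl {x = h})))
        (≡mod-reflexive (trans (cong (λ z → approx n + z) (ℤ.*-zeroˡ h)) (ℤ.+-identityʳ (approx n))))

      approx≡w₀ zero    = ≡mod-refl
      approx≡w₀ (suc n) = ≡mod-trans (≡mod-weaken (p∣p^[1+n] n) (approx-compatible n)) (approx≡w₀ n)

      approx-square zero    = ≡mod-p⇒≡mod-p^1 w₀²≡s₁
      approx-square (suc n) =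
        subst (λ m → approx (suc n) * approx (suc n) ≡ s (suc (suc n)) [mod m ]) (p^[1+n]*p≡p^[2+n] n)
          (≡mod-trans (newton-sqrt-step {a = approx n} (p∣p^[1+n] n) (error≡0 n) 2ah≡1)
                      (≡mod-reflexive (a+[s-a]≡s (approx n * approx n) (s (suc (suc n))))))
        where
        2ah≡1 : + 2 * approx n * h ≡ + 1 [mod + p ]
        2ah≡1 =
          ≡mod-trans (*-cong-mod (*-cong-mod (≡mod-refl {x = + 2}) (approx≡w₀ n)) ≡mod-refl) 2w₀h≡1
        a+[s-a]≡s : ∀ a s → a + (s - a) ≡ s
        a+[s-a]≡s = solve-∀

    sqrtSeq : Seq
    sqrtSeq zero    = w₀
    sqrtSeq (suc n) = approx n

    sqrtSeq-compatible : Compatible p sqrtSeq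
    sqrtSeq-compatible = ≡mod⇒compatible {f = sqrtSeq} λ where
      zero    → ≡mod-1
      (suc n) → approx-compatible n

    sqrtSeq-square : ∀ n → sqrtSeq n * sqrtSeq n ≡ s n [mod + (p ℕ.^ n) ]
    sqrtSeq-square zero    = ≡mod-1
    sqrtSeq-square (suc n) = approx-square n

    sqrtSeq-unit : IsUnit p sqrtSeq
    sqrtSeq-unit = compatible-unit sqrtSeq sqrtSeq-compatible p∤w₀

  -- Reduction of p-integral rationals modulo p

  record Residue (r : ℚ) (z : ℤ) : Set where
    constructor residue
    field
      den-unit : p ∤ᶻ ↧ r
      z*den≡num : z * ↧ r ≡ ↥ r [mod + p ]
  open Residue

  ↧-∣-fraction-den : ∀ r {N D} → ↥ r * D ≡ N * ↧ r → ↧ₙ r ℕ.∣ ℤ.∣ D ∣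
  ↧-∣-fraction-den r@(mkℚ _ _ coprime) {N} {D} eq =
    Coprime.coprime-divisor (Coprime.sym (Coprime.recompute coprime))
    (subst (↧ₙ r ℕ.∣_) (trans (cong ℤ.∣_∣ (sym eq)) (ℤ.abs-* (↥ r) D))
      (subst (↧ₙ r ℕ.∣_) (sym (ℤ.abs-* N (↧ r))) (ℕ.n∣m*n ℤ.∣ N ∣)))

  residue-of-fraction : ∀ {r N D z} → ↥ r * D ≡ N * ↧ r → p ∤ᶻ D → z * D ≡ N [mod + p ] →
                        Residue r z
  residue-of-fraction {r} {N} {D} {z} eq p∤D zD≡N = residue p∤↧r (≡mod-cancelˡ {x = D} p∤D (begin
    D * (z * ↧ r)  ≡⟨ D[zd]≡zDd D z (↧ r) ⟩
    z * D * ↧ r    ≈⟨ *-cong-mod zD≡N ≡mod-refl ⟩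
    N * ↧ r        ≡⟨ eq ⟨
    ↥ r * D        ≡⟨ ℤ.*-comm (↥ r) D ⟩
    D * ↥ r        ∎))
    where
    open ≡mod-Reasoning (+ p)
    p∤↧r : p ∤ᶻ ↧ r
    p∤↧r p∣↧r = p∤D (ℕ.∣-trans p∣↧r (↧-∣-fraction-den r {N} eq))
    D[zd]≡zDd : ∀ D z d → D * (z * d) ≡ z * D * d
    D[zd]≡zDd = solve-∀

  residue-unique : ∀ {r z z′} → Residue r z → Residue r z′ → z ≡ z′ [mod + p ]
  residue-unique {r} {z} {z′} (residue p∤↧r zd≡n) (residue _ z′d≡n) = ≡mod-cancelˡ {x = ↧ r} p∤↧r
    (≡mod-trans (≡mod-reflexive (ℤ.*-comm (↧ r) z))
      (≡mod-trans zd≡n (≡mod-trans (≡mod-sym z′d≡n) (≡mod-reflexive (ℤ.*-comm z′ (↧ r))))))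

  residue-resp-≡mod : ∀ {r z z′} → Residue r z → z ≡ z′ [mod + p ] → Residue r z′
  residue-resp-≡mod (residue p∤↧r zd≡n) z≡z′ =
    residue p∤↧r (≡mod-trans (*-cong-mod (≡mod-sym z≡z′) ≡mod-refl) zd≡n)

  residue-ι : ∀ r → p ∤ᶻ ↧ r → Residue r (ι p r 1)
  residue-ι r p∤↧r = residue p∤↧r (begin
    ↥ r * d ^ e * d    ≡⟨ n[d^e]d≡n[d*d^e] (↥ r) d (d ^ e) ⟩
    ↥ r * (d * d ^ e)
      ≈⟨ *-cong-mod (≡mod-refl {x = ↥ r}) (≡mod-weaken (p∣p^[1+n] 1) (euler-inverse 1 {d} p∤↧r)) ⟩
    ↥ r * + 1          ≡⟨ ℤ.*-identityʳ (↥ r) ⟩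
    ↥ r                ∎)
    where
    open ≡mod-Reasoning (+ p)
    d = ↧ r
    e = p ℕ.^ 1 ℕ.* (p ∸ 1) ∸ 1
    n[d^e]d≡n[d*d^e] : ∀ n d x → n * x * d ≡ n * (d * x)
    n[d^e]d≡n[d*d^e] = solve-∀

  residue-num-unit⇒ : ∀ {r z} → Residue r z → p ∤ᶻ ↥ r → p ∤ᶻ z
  residue-num-unit⇒ {r} {z} (residue _ zd≡n) p∤↥r =
    ∤ᶻ-*ˡ {x = z} {y = ↧ r} (∤ᶻ-resp-≡mod (≡mod-sym zd≡n) p∤↥r)

  residue-num-unit⇐ : ∀ {r z} → Residue r z → p ∤ᶻ z → p ∤ᶻ ↥ r
  residue-num-unit⇐ {r} {z} (residue p∤↧r zd≡n) p∤z =
    ∤ᶻ-resp-≡mod zd≡n (∤ᶻ-* {z} {↧ r} p∤z p∤↧r)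

  residue-num-divisible : ∀ {r z} → Residue r z → p ℕ.∣ ℤ.∣ ↥ r ∣ → z ≡ + 0 [mod + p ]
  residue-num-divisible {r} {z} (residue p∤↧r zd≡n) p∣↥r = ≡mod-cancelˡ {x = ↧ r} p∤↧r (begin
    ↧ r * z     ≡⟨ ℤ.*-comm (↧ r) z ⟩
    z * ↧ r     ≈⟨ zd≡n ⟩
    ↥ r         ≈⟨ ∣⇒≡0-mod (∣ᵤ⇒∣ p∣↥r) ⟩
    + 0         ≡⟨ ℤ.*-zeroʳ (↧ r) ⟨
    ↧ r * + 0   ∎)
    where open ≡mod-Reasoning (+ p)

  -- Rational arithmetic normalises, so residues of sums and products are read off the
  -- unnormalised fractions provided by the toℚᵘ-homomorphism lemmas.
  residue-of-ℚᵘ : ∀ {r z} (u : ℚᵘ.ℚᵘ) → ℚ.toℚᵘ r ℚᵘ.≃ u → p ∤ᶻ ℚᵘ.↧ u →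
                  z * ℚᵘ.↧ u ≡ ℚᵘ.↥ u [mod + p ] → Residue r z
  residue-of-ℚᵘ {mkℚ _ _ _} u (ℚᵘ.*≡* eq) = residue-of-fraction eq

  residue-1 : Residue ℚ.1ℚ (+ 1)
  residue-1 = residue ∤ᶻ-1 ≡mod-refl

  residue-+ : ∀ {r s z w} → Residue r z → Residue s w → Residue (r ℚ.+ s) (z + w)
  residue-+ {r@(mkℚ _ _ _)} {s@(mkℚ _ _ _)} {z} {w} (residue p∤↧r zd≡n) (residue p∤↧s we≡m) =
    residue-of-ℚᵘ _ (ℚ.toℚᵘ-homo-+ r s) (∤ᶻ-* {↧ r} {↧ s} p∤↧r p∤↧s) (begin
      (z + w) * (↧ r * ↧ s)              ≡⟨ distribute z w (↧ r) (↧ s) ⟩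
      z * ↧ r * ↧ s + w * ↧ s * ↧ r
        ≈⟨ +-cong-mod (*-cong-mod zd≡n ≡mod-refl) (*-cong-mod we≡m ≡mod-refl) ⟩
      ↥ r * ↧ s + ↥ s * ↧ r              ∎)
    where
    open ≡mod-Reasoning (+ p)
    distribute : ∀ z w a b → (z + w) * (a * b) ≡ z * a * b + w * b * a
    distribute = solve-∀

  residue-* : ∀ {r s z w} → Residue r z → Residue s w → Residue (r ℚ.* s) (z * w)
  residue-* {r@(mkℚ _ _ _)} {s@(mkℚ _ _ _)} {z} {w} (residue p∤↧r zd≡n) (residue p∤↧s we≡m) =
    residue-of-ℚᵘ _ (ℚ.toℚᵘ-homo-* r s) (∤ᶻ-* {↧ r} {↧ s} p∤↧r p∤↧s)
      (≡mod-trans (≡mod-reflexive (interchange z w (↧ r) (↧ s))) (*-cong-mod zd≡n we≡m))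

  residue-neg : ∀ {r z} → Residue r z → Residue (ℚ.- r) (- z)
  residue-neg {r@(mkℚ _ _ _)} {z} (residue p∤↧r zd≡n) =
    residue-of-ℚᵘ _ (ℚ.toℚᵘ-homo‿- r) p∤↧r
      (≡mod-trans (≡mod-reflexive (sym (ℤ.neg-distribˡ-* z (↧ r)))) (neg-cong-mod zd≡n))

  residue-1/ : ∀ {r z z⁻¹} .{{_ : ℚ.NonZero r}} → Residue r z → p ∤ᶻ ↥ r →
               z * z⁻¹ ≡ + 1 [mod + p ] → Residue (ℚ.1/ r) z⁻¹
  residue-1/ {r} {z} {z⁻¹} (residue _ zd≡n) p∤↥r zz⁻¹≡1 =
    residue-of-fraction (↥1/r*↥r≡↧r*↧1/r r) p∤↥r (begin
    z⁻¹ * ↥ r          ≈⟨ *-cong-mod (≡mod-refl {x = z⁻¹}) (≡mod-sym zd≡n) ⟩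
    z⁻¹ * (z * ↧ r)    ≡⟨ rearrange z⁻¹ z (↧ r) ⟩
    z * z⁻¹ * ↧ r      ≈⟨ *-cong-mod zz⁻¹≡1 ≡mod-refl ⟩
    + 1 * ↧ r          ≡⟨ ℤ.*-identityˡ (↧ r) ⟩
    ↧ r                ∎)
    where
    open ≡mod-Reasoning (+ p)
    rearrange : ∀ a b c → a * (b * c) ≡ b * a * c
    rearrange = solve-∀
    ↥1/r*↥r≡↧r*↧1/r : ∀ r .{{_ : ℚ.NonZero r}} → ↥ (ℚ.1/ r) * ↥ r ≡ ↧ r * ↧ (ℚ.1/ r)
    ↥1/r*↥r≡↧r*↧1/r (mkℚ ℤ.+[1+ _ ] _ _) = refl
    ↥1/r*↥r≡↧r*↧1/r (mkℚ ℤ.-[1+ _ ] _ _) = refl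

  residue-divQ : ∀ {r s z w w⁻¹} → Residue r z → Residue s w → s ≢ ℚ.0ℚ → p ∤ᶻ ↥ s →
                 w * w⁻¹ ≡ + 1 [mod + p ] → Residue (divQ r s) (z * w⁻¹)
  residue-divQ {r} {s} {z} {w} {w⁻¹} r↦z s↦w s≢0 p∤↥s ww⁻¹≡1 with s ℚ.≟ ℚ.0ℚ
  ... | yes s≡0 = contradiction s≡0 s≢0
  ... | no  s≢0′ = residue-* r↦z (residue-1/ {{ℚ.≢-nonZero s≢0′}} s↦w p∤↥s ww⁻¹≡1)

  num-unit-*ˡ : ∀ {r s} → p ∤ᶻ ↧ r → p ∤ᶻ ↧ s → p ∤ᶻ ↥ (r ℚ.* s) → p ∤ᶻ ↥ r
  num-unit-*ˡ {r} {s} p∤↧r p∤↧s p∤↥rs = residue-num-unit⇐ r↦ (∤ᶻ-*ˡ {x = ι p r 1} {y = ι p s 1}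
    (residue-num-unit⇒ (residue-* r↦ (residue-ι s p∤↧s)) p∤↥rs))
    where r↦ = residue-ι r p∤↧r

  -- ι p r is, definitionally, ↥ r times the inverse sequence of the constant ↧ r.
  ι-compatible : ∀ r → p ∤ᶻ ↧ r → Compatible p (ι p r)
  ι-compatible r p∤↧r = compatible-* {f = λ _ → ↥ r} {g = inverseSeq (λ _ → ↧ r)}
    (compatible-const (↥ r)) (inverseSeq-compatible (λ _ → ↧ r) (compatible-const (↧ r)) p∤↧r)

  prodSelSeq-compatible : ∀ {k} S (g : Fin k → Seq) → (∀ j → Compatible p (g j)) →
                          Compatible p (prodSelSeq p S g)
  prodSelSeq-compatible {zero}  S g _      = compatible-const (+ 1)
  prodSelSeq-compatible {suc k} S g g-comp with S Fin.zero
  ... | true  = compatible-* {f = g Fin.zero} {g = prodSelSeq p (λ j → S (Fin.suc j)) (λ j → g (Fin.suc j))}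
                  (g-comp Fin.zero) (prodSelSeq-compatible _ _ (λ j → g-comp (Fin.suc j)))
  ... | false = prodSelSeq-compatible _ _ (λ j → g-comp (Fin.suc j))

  prodSelSeq-residue : ∀ {k} S (f : Fin k → ℚ) (g : Fin k → Seq) → (∀ j → Residue (f j) (g j 1)) →
                       Residue (prodSelℚ S f) (prodSelSeq p S g 1)
  prodSelSeq-residue {zero}  S f g _   = residue-1
  prodSelSeq-residue {suc k} S f g f↦g with S Fin.zero
  ... | true  = residue-* (f↦g Fin.zero) (prodSelSeq-residue _ _ _ (λ j → f↦g (Fin.suc j)))
  ... | false = prodSelSeq-residue _ _ _ (λ j → f↦g (Fin.suc j))

  prodSelSeq-unit : ∀ {k} S (g : Fin k → Seq) → (∀ j → S j ≡ true → p ∤ᶻ g j 1) →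
                    p ∤ᶻ prodSelSeq p S g 1
  prodSelSeq-unit {zero}  S g _      = ∤ᶻ-1
  prodSelSeq-unit {suc k} S g g-unit with S Fin.zero in S₀≡
  ... | true  = ∤ᶻ-* {g Fin.zero 1} (g-unit Fin.zero S₀≡) (prodSelSeq-unit _ _ (λ j → g-unit (Fin.suc j)))
  ... | false = prodSelSeq-unit _ _ (λ j → g-unit (Fin.suc j))

  prodSelSeq-≡0 : ∀ {k} S (g : Fin k → Seq) i → S i ≡ true → g i 1 ≡ + 0 [mod + p ] →
                  prodSelSeq p S g 1 ≡ + 0 [mod + p ]
  prodSelSeq-≡0 {suc k} S g Fin.zero Sᵢ≡ gᵢ≡0 with S Fin.zero
  prodSelSeq-≡0 {suc k} S g Fin.zero refl gᵢ≡0 | true =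
    ≡mod-trans (*-cong-mod gᵢ≡0 ≡mod-refl)
               (≡mod-reflexive (ℤ.*-zeroˡ (prodSelSeq p (λ j → S (Fin.suc j)) (λ j → g (Fin.suc j)) 1)))
  prodSelSeq-≡0 {suc k} S g (Fin.suc i) Sᵢ≡ gᵢ≡0 with S Fin.zero
  ... | true  = ≡mod-trans (*-cong-mod (≡mod-refl {x = g Fin.zero 1}) (prodSelSeq-≡0 _ _ i Sᵢ≡ gᵢ≡0))
                  (≡mod-reflexive (ℤ.*-zeroʳ (g Fin.zero 1)))
  ... | false = prodSelSeq-≡0 _ _ i Sᵢ≡ gᵢ≡0

  -- The fibre criterion

  module _ (p≢2 : p ≢ 2) where

    square-unit-criterion : ∀ {R z} → Residue R z → p ∤ᶻ z →
                            SquareUnit p R ⇔ SquareMod (+ p) z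
    square-unit-criterion {R} {z} R↦z p∤z = mk⇔ to from
      where
      ιR₁≡z : ι p R 1 ≡ z [mod + p ]
      ιR₁≡z = residue-unique (residue-ι R (den-unit R↦z)) R↦z
      p∤ιR₁ : p ∤ᶻ ι p R 1
      p∤ιR₁ = ∤ᶻ-resp-≡mod (≡mod-sym ιR₁≡z) p∤z

      to : SquareUnit p R → SquareMod (+ p) z
      to (_ , (u , _) , _ , u²≈ιR) =
        u 1 , ≡mod-trans (≡mod-p^1⇒≡mod-p (≈⇒≡mod {f = λ n → u n * u n} {g = ι p R} u²≈ιR 1))
                         ιR₁≡z

      from : SquareMod (+ p) z → SquareUnit p R
      from (w , w²≡z) = den-unit R↦z , (sqrtSeq , sqrtSeq-compatible) , sqrtSeq-unit ,
                        ≡mod⇒≈ {f = λ n → sqrtSeq n * sqrtSeq n} {g = ι p R} sqrtSeq-square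
        where open Hensel p≢2 (ι p R) (ι-compatible R (den-unit R↦z)) p∤ιR₁
                          w (≡mod-trans w²≡z (≡mod-sym ιR₁≡z))

    conic-criterion : ∀ {Q B} → Compatible p Q → p ∤ᶻ Q 1 → B 1 ≡ + 0 [mod + p ] →
                      ConicPoint p Q B ⇔ SquareMod (+ p) (Q 1)
    conic-criterion {Q} {B} Q-comp p∤Q₁ B₁≡0 = mk⇔ to from
      where
      to : ConicPoint p Q B → SquareMod (+ p) (Q 1)
      to ((x , _) , (y , _) , conic) = Q 1 * x 1 , (begin
        Q 1 * x 1 * (Q 1 * x 1)                 ≡⟨ regroup (Q 1) (x 1) ⟩
        Q 1 * (Q 1 * (x 1 * x 1))               ≈⟨ *-cong-mod (≡mod-refl {x = Q 1}) Qx²≡1 ⟩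
        Q 1 * + 1                               ≡⟨ ℤ.*-identityʳ (Q 1) ⟩
        Q 1                                     ∎)
        where
        open ≡mod-Reasoning (+ p)
        regroup : ∀ q x → q * x * (q * x) ≡ q * (q * (x * x))
        regroup = solve-∀
        By²≡0 : B 1 * (y 1 * y 1) ≡ + 0 [mod + p ]
        By²≡0 = ≡mod-trans (*-cong-mod B₁≡0 (≡mod-refl {x = y 1 * y 1}))
                           (≡mod-reflexive (ℤ.*-zeroˡ (y 1 * y 1)))
        Qx²≡1 : Q 1 * (x 1 * x 1) ≡ + 1 [mod + p ]
        Qx²≡1 = begin
          Q 1 * (x 1 * x 1)                      ≡⟨ ℤ.+-identityʳ _ ⟨
          Q 1 * (x 1 * x 1) + + 0                ≈⟨ +-cong-mod (≡mod-refl {x = Q 1 * (x 1 * x 1)}) By²≡0 ⟨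
          Q 1 * (x 1 * x 1) + B 1 * (y 1 * y 1)
            ≈⟨ ≡mod-p^1⇒≡mod-p (≈⇒≡mod {f = conic-lhs} {g = λ _ → + 1} conic 1) ⟩
          + 1                                    ∎
          where conic-lhs = λ n → Q n * (x n * x n) + B n * (y n * y n)

      from : SquareMod (+ p) (Q 1) → ConicPoint p Q B
      from (w , w²≡Q₁) = (x , compatible-* {f = sqrtSeq} {g = q} sqrtSeq-compatible q-comp) ,
                         ((λ _ → + 0) , compatible-const (+ 0)) ,
                         ≡mod⇒≈ {g = λ _ → + 1} conic
        where
        open Hensel p≢2 Q Q-comp p∤Q₁ w w²≡Q₁
        q = inverseSeq Q
        q-comp = inverseSeq-compatible Q Q-comp p∤Q₁
        x : Seq
        x n = sqrtSeq n * q n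
        regroup : ∀ Q z q b → Q * (z * q * (z * q)) + b * (+ 0 * + 0) ≡ z * z * (q * (Q * q))
        regroup = solve-∀
        regroup′ : ∀ Q q → Q * (q * (Q * q)) ≡ Q * q * (Q * q)
        regroup′ = solve-∀
        conic : ∀ n → Q n * (x n * x n) + B n * (+ 0 * + 0) ≡ + 1 [mod + (p ℕ.^ n) ]
        conic n = begin
          Q n * (x n * x n) + B n * (+ 0 * + 0)  ≡⟨ regroup (Q n) (sqrtSeq n) (q n) (B n) ⟩
          sqrtSeq n * sqrtSeq n * (q n * (Q n * q n))
                                                 ≈⟨ *-cong-mod (sqrtSeq-square n) ≡mod-refl ⟩
          Q n * (q n * (Q n * q n))              ≡⟨ regroup′ (Q n) (q n) ⟩
          Q n * q n * (Q n * q n)                ≈⟨ *-cong-mod Qq≡1 Qq≡1 ⟩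
          + 1                                    ∎
          where
          open ≡mod-Reasoning (+ (p ℕ.^ n))
          Qq≡1 = inverseSeq-inverse Q Q-comp p∤Q₁ n

  module _ {k} (c d : Fin k → ℚ)
           (p∤↧c : ∀ j → p ∤ᶻ ↧ (c j)) (p∤↧d : ∀ j → p ∤ᶻ ↧ (d j))
           (t : Seq) (t-comp : Compatible p t) where

    private
      c↦ : ∀ j → Residue (c j) (ι p (c j) 1)
      c↦ j = residue-ι (c j) (p∤↧c j)
      d↦ : ∀ j → Residue (d j) (ι p (d j) 1)
      d↦ j = residue-ι (d j) (p∤↧d j)

    pᵢ-compatible : ∀ j → Compatible p (pᵢ p c d j t)
    pᵢ-compatible j = compatible-+ {f = λ n → ι p (c j) n * t n} {g = ι p (d j)}
      (compatible-* {f = ι p (c j)} {g = t} (ι-compatible (c j) (p∤↧c j)) t-comp) (ι-compatible (d j) (p∤↧d j))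

    pᵢ-residue : ∀ {r₀} → Residue r₀ (t 1) → ∀ j → Residue (c j ℚ.* r₀ ℚ.+ d j) (pᵢ p c d j t 1)
    pᵢ-residue r₀↦t₁ j = residue-+ (residue-* (c↦ j) r₀↦t₁) (d↦ j)

    fibre-criterion : p ≢ 2 → ∀ {r₀} α β (S S′ : Fin k → Bool) i →
      Residue r₀ (t 1) → p ∤ᶻ ↧ α → p ∤ᶻ ↥ α →
      (∀ j → S j ≡ true → p ∤ᶻ pᵢ p c d j t 1) → S′ i ≡ true → pᵢ p c d i t 1 ≡ + 0 [mod + p ] →
      ConicPoint p (λ n → ι p α n * pSel p c d S t n) (λ n → ι p β n * pSel p c d S′ t n)
        ⇔ SquareUnit p (α ℚ.* pSelℚ c d S r₀)
    fibre-criterion p≢2 {r₀} α β S S′ i r₀↦t₁ p∤↧α p∤↥α S-units S′ᵢ pᵢ[t]≡0 =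
      ⇔-sym (square-unit-criterion p≢2 R↦Q₁ p∤Q₁) ⇔-∘ conic-criterion p≢2 {Q} {B} Q-comp p∤Q₁ B₁≡0
      where
      Q B : Seq
      Q n = ι p α n * pSel p c d S t n
      B n = ι p β n * pSel p c d S′ t n
      α↦ = residue-ι α p∤↧α
      Q-comp : Compatible p Q
      Q-comp = compatible-* {f = ι p α} {g = pSel p c d S t}
                 (ι-compatible α p∤↧α) (prodSelSeq-compatible S _ pᵢ-compatible)
      p∤Q₁ : p ∤ᶻ ι p α 1 * pSel p c d S t 1
      p∤Q₁ = ∤ᶻ-* {ι p α 1} (residue-num-unit⇒ α↦ p∤↥α) (prodSelSeq-unit S _ S-units)
      B₁≡0 : ι p β 1 * pSel p c d S′ t 1 ≡ + 0 [mod + p ]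
      B₁≡0 = ≡mod-trans (*-cong-mod (≡mod-refl {x = ι p β 1}) (prodSelSeq-≡0 S′ _ i S′ᵢ pᵢ[t]≡0))
                        (≡mod-reflexive (ℤ.*-zeroʳ (ι p β 1)))
      R↦Q₁ : Residue (α ℚ.* pSelℚ c d S r₀) (ι p α 1 * pSel p c d S t 1)
      R↦Q₁ = residue-* α↦ (prodSelSeq-residue S _ _ (pᵢ-residue r₀↦t₁))

    module _ {i} (pᵢ[t]≡0 : pᵢ p c d i t 1 ≡ + 0 [mod + p ]) where

      private
        zc = ι p (c i) 1
        zd = ι p (d i) 1
        T  = t 1

      coprime⇒p∤↥cᵢ : ∀ {u w} → p ∤ᶻ ↧ u → p ∤ᶻ ↧ w →
                      u ℚ.* c i ℚ.+ w ℚ.* d i ≡ ℚ.1ℚ → p ∤ᶻ ↥ (c i)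
      coprime⇒p∤↥cᵢ {u} {w} p∤↧u p∤↧w uc+wd≡1 p∣↥cᵢ =
        ∤ᶻ-1 (∣⇒∣ᵤ (≡0-mod⇒∣ 1≡0))
        where
        open ≡mod-Reasoning (+ p)
        zu = ι p u 1
        zw = ι p w 1
        zc≡0 : zc ≡ + 0 [mod + p ]
        zc≡0 = residue-num-divisible (c↦ i) p∣↥cᵢ
        zd≡0 : zd ≡ + 0 [mod + p ]
        zd≡0 = begin
          zd                          ≡⟨ isolate zc T zd ⟩
          (zc * T + zd) + - (zc * T)
            ≈⟨ +-cong-mod pᵢ[t]≡0 (neg-cong-mod (*-cong-mod zc≡0 (≡mod-refl {x = T}))) ⟩
          + 0 + - (+ 0 * T)           ≡⟨ vanish T ⟩
          + 0                         ∎
          where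
          isolate : ∀ x t y → y ≡ (x * t + y) + - (x * t)
          isolate = solve-∀
          vanish : ∀ t → + 0 + - (+ 0 * t) ≡ + 0
          vanish = solve-∀
        1≡0 : + 1 ≡ + 0 [mod + p ]
        1≡0 = begin
          + 1                  ≈⟨ residue-unique residue-1 (subst (λ r → Residue r (zu * zc + zw * zd)) uc+wd≡1
                                    (residue-+ (residue-* (residue-ι u p∤↧u) (c↦ i))
                                               (residue-* (residue-ι w p∤↧w) (d↦ i)))) ⟩
          zu * zc + zw * zd    ≈⟨ +-cong-mod (*-cong-mod (≡mod-refl {x = zu}) zc≡0)
                                             (*-cong-mod (≡mod-refl {x = zw}) zd≡0) ⟩
          zu * + 0 + zw * + 0  ≡⟨ cong₂ _+_ (ℤ.*-zeroʳ zu) (ℤ.*-zeroʳ zw) ⟩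
          + 0                  ∎

      module _ (cᵢ≢0 : c i ≢ ℚ.0ℚ) (p∤↥cᵢ : p ∤ᶻ ↥ (c i)) where

        private
          p∤zc : p ∤ᶻ zc
          p∤zc = residue-num-unit⇒ (c↦ i) p∤↥cᵢ
          zc⁻¹ = proj₁ (mod-p-inverse zc p∤zc)
          zc*zc⁻¹≡1 : zc * zc⁻¹ ≡ + 1 [mod + p ]
          zc*zc⁻¹≡1 = proj₂ (mod-p-inverse zc p∤zc)

        quotient-residue : Residue (divQ (d i) (c i)) (- T)
        quotient-residue =
          residue-resp-≡mod (residue-divQ (d↦ i) (c↦ i) cᵢ≢0 p∤↥cᵢ zc*zc⁻¹≡1) (begin
          zd * zc⁻¹                                ≡⟨ isolate zc T zd zc⁻¹ ⟩
          (zc * T + zd) * zc⁻¹ + - T * (zc * zc⁻¹)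
            ≈⟨ +-cong-mod (*-cong-mod pᵢ[t]≡0 (≡mod-refl {x = zc⁻¹})) (*-cong-mod (≡mod-refl {x = - T}) zc*zc⁻¹≡1) ⟩
          + 0 * zc⁻¹ + - T * + 1                   ≡⟨ vanish T zc⁻¹ ⟩
          - T                                      ∎)
          where
          open ≡mod-Reasoning (+ p)
          isolate : ∀ x t y x⁻¹ → y * x⁻¹ ≡ (x * t + y) * x⁻¹ + - t * (x * x⁻¹)
          isolate = solve-∀
          vanish : ∀ t x⁻¹ → + 0 * x⁻¹ + - t * + 1 ≡ - t
          vanish = solve-∀

        root-residue : Residue (ℚ.- divQ (d i) (c i)) T
        root-residue = residue-resp-≡mod (residue-neg quotient-residue) (≡mod-reflexive (ℤ.neg-involutive T))

        Δ-residue : ∀ j → Residue (Δ c d j i) (- pᵢ p c d j t 1)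
        Δ-residue j = residue-resp-≡mod (residue-+ (residue-* (c↦ j) quotient-residue) (residue-neg (d↦ j)))
          (≡mod-reflexive (negate (ι p (c j) 1) T (ι p (d j) 1)))
          where
          negate : ∀ x t y → x * - t + - y ≡ - (x * t + y)
          negate = solve-∀

        pⱼ-unit : ∀ j → p ∤ᶻ ↥ (Δ c d j i) → p ∤ᶻ pᵢ p c d j t 1
        pⱼ-unit j p∤↥Δ = ∤ᶻ-neg {x = pᵢ p c d j t 1} (residue-num-unit⇒ (Δ-residue j) p∤↥Δ)

        units-away-from-i : (∀ j → j ≢ i → p ∤ᶻ ↥ (Δ c d j i)) →
                            ∀ (S : Fin k → Bool) → S i ≡ false →
                            ∀ j → S j ≡ true → p ∤ᶻ pᵢ p c d j t 1
        units-away-from-i Δ-unit S Sᵢ≡false j Sⱼ≡true = pⱼ-unit j (Δ-unit j j≢i)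
          where
          j≢i : j ≢ i
          j≢i refl = contradiction (trans (sym Sⱼ≡true) Sᵢ≡false) λ ()

        fibre-point-criterion : p ≢ 2 → ∀ a b →
          p ∤ᶻ ↧ a → p ∤ᶻ ↧ b → p ∤ᶻ ↥ a → p ∤ᶻ ↥ b →
          (∀ j → j ≢ i → p ∤ᶻ ↥ (Δ c d j i)) → (inA : Fin k → Bool) →
          FibrePoint p c d a b inA t
            ⇔ ((inA i ≡ false → SquareUnit p (a ℚ.* pSelℚ c d inA (ℚ.- divQ (d i) (c i))))
             × (inA i ≡ true → SquareUnit p (b ℚ.* pSelℚ c d (not ∘ inA) (ℚ.- divQ (d i) (c i)))))
        fibre-point-criterion p≢2 a b p∤↧a p∤↧b p∤↥a p∤↥b Δ-unit inA with inA i in inAᵢ≡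
        ... | false = mk⇔ (λ pt → (λ _ → Equivalence.to A-criterion pt) , λ ())
                          (λ (A-square , _) → Equivalence.from A-criterion (A-square refl))
          where
          A-criterion = fibre-criterion p≢2 a b inA (not ∘ inA) i root-residue p∤↧a p∤↥a
                          (units-away-from-i Δ-unit inA inAᵢ≡) (cong not inAᵢ≡) pᵢ[t]≡0
        ... | true  = mk⇔ (λ pt → (λ ()) , λ _ → Equivalence.to B-criterion (conic-point-swap Qa Qb pt))
                          (λ (_ , B-square) →
                             conic-point-swap Qb Qa (Equivalence.from B-criterion (B-square refl)))
          where
          B-criterion = fibre-criterion p≢2 b a (not ∘ inA) inA i root-residue p∤↧b p∤↥b
                          (units-away-from-i Δ-unit (not ∘ inA) (cong not inAᵢ≡)) inAᵢ≡ pᵢ[t]≡0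
          Qa Qb : Seq
          Qa n = ι p a n * pSel p c d inA t n
          Qb n = ι p b n * pSel p c d (not ∘ inA) t n

lemma6p3 : (S₀ : List ℕ) → All Prime S₀ →
    (m : ℕ) → (c d : Fin (suc m) → ℚ) →
    (∀ i → IsSInt S₀ (c i)) → (∀ i → IsSInt S₀ (d i)) →
    (∀ i → CoprimeS S₀ (c i) (d i)) → (∀ i → c i ≢ 0ℚ) →
    (∀ i j → i ≢ j → Δ c d i j ≢ 0ℚ) →
    (a b : ℚ) → IsSInt S₀ a → IsSInt S₀ b → a ≢ 0ℚ → b ≢ 0ℚ →
    (inA : Fin (suc m) → Bool) →
    (v : ℕ) → Prime v → v ∉ S₀ → ¬ Bad v c d (a ℚ.* b) →
    (t : Zp v) → IsUnit v (proj₁ t) →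
    (i : Fin (suc m)) → ValPos v (pᵢ v c d i (proj₁ t)) →
    (FibrePoint v c d a b inA (proj₁ t)
      ⇔ ((inA i ≡ false → SquareUnit v (a ℚ.* pSelℚ c d inA (ℚ.- divQ (d i) (c i))))
         × (inA i ≡ true → SquareUnit v (b ℚ.* pSelℚ c d (λ j → not (inA j)) (ℚ.- divQ (d i) (c i))))))
lemma6p3 S₀ _ m c d c-int d-int coprime c≢0 _ a b a-int b-int _ _ inA v v-prime v∉S₀ ¬bad
         (t , t-comp) _ i v∣pᵢ[t] =
  fibre-point-criterion v-prime c d v∤↧c v∤↧d t t-comp pᵢ[t]≡0 (c≢0 i) v∤↥cᵢ
    v≢2 a b (den-unit a a-int) (den-unit b b-int) v∤↥a v∤↥b v∤↥Δ inA
  where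
  den-unit : ∀ r → IsSInt S₀ r → v ∤ᶻ ↧ r
  den-unit _ r-int v∣↧r = v∉S₀ (r-int v v-prime v∣↧r)
  v∤↧c : ∀ j → v ∤ᶻ ↧ (c j)
  v∤↧c j = den-unit (c j) (c-int j)
  v∤↧d : ∀ j → v ∤ᶻ ↧ (d j)
  v∤↧d j = den-unit (d j) (d-int j)
  v≢2 : v ≢ 2
  v≢2 v≡2 = ¬bad (inj₂ (inj₂ (inj₁ v≡2)))
  v∤↥Δ : ∀ j → j ≢ i → v ∤ᶻ ↥ (Δ c d j i)
  v∤↥Δ j j≢i v∣↥Δ = ¬bad (inj₁ (j , i , j≢i , v∣↥Δ))
  v∤↥ab : v ∤ᶻ ↥ (a ℚ.* b)
  v∤↥ab v∣↥ab = ¬bad (inj₂ (inj₁ v∣↥ab))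
  v∤↥a : v ∤ᶻ ↥ a
  v∤↥a = num-unit-*ˡ v-prime {a} {b} (den-unit a a-int) (den-unit b b-int) v∤↥ab
  v∤↥b : v ∤ᶻ ↥ b
  v∤↥b = num-unit-*ˡ v-prime {b} {a} (den-unit b b-int) (den-unit a a-int)
           (subst (λ r → v ∤ᶻ ↥ r) (ℚ.*-comm a b) v∤↥ab)
  pᵢ[t]≡0 : pᵢ v c d i t 1 ≡ + 0 [mod + v ]
  pᵢ[t]≡0 = ∣⇒≡0-mod (∣ᵤ⇒∣ v∣pᵢ[t])
  v∤↥cᵢ : v ∤ᶻ ↥ (c i)
  v∤↥cᵢ with coprime i
  ... | u , w , u-int , w-int , uc+wd≡1 =
    coprime⇒p∤↥cᵢ v-prime c d v∤↧c v∤↧d t t-comp pᵢ[t]≡0 {u} {w} (den-unit u u-int) (den-unit w w-int) uc+wd≡1
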